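{- Let $\mathcal{L}=\langle\mathcal{C},\mathcal{P}\rangle$ be a first-order language with $c_1,c_2\in\mathcal{C}$. Let $\mathcal{K}=\langle W,\le,d,I,i_+,i_-\rangle$ be a Kripke $F\!F\!D\!E$-model for $\mathcal{L}$ and $w\in W$, and suppose $I(c_2,w)$ is defined, with $I(c_2,w)=a\in d(w)$. Let $\mathcal{K}_{c_2/c_1}=\langle W,\le,d,I_{c_2/c_1},i_+,i_-\rangle$, where $I_{c_2/c_1}$ agrees with $I$ on all elements of $\mathcal{P}\cup(\mathcal{C}\setminus\{c_1\})$, $I_{c_2/c_1}(c_1,w')=a$ for every $w'\in W$ such that $I(c_2,w')$ is defined, and $I_{c_2/c_1}(c_1,w')$ is undefined otherwise. If $A\in Form(\mathcal{L})$ has at most $x$ free and $c_1$ does not occur in $A$, then $\mathcal{K}_{c_2/c_1},w\vDash A(c_1/x)$ iff $\mathcal{K},w\vDash A(c_2/x)$.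
   Context: Language: connectives $\neg,\land,\lor$, quantifiers $\forall,\exists$, variables, identity $\doteq$ and unary definedness predicate $\mathbf{D}$. A first-order language is $\mathcal{L}=\langle\mathcal{C},\mathcal{P}\rangle$, $\mathcal{C}$ an infinite set of constants, $\mathcal{P}$ a set of predicate letters of finite arities; $\mathcal{P}^{\doteq}=\mathcal{P}\cup\{\doteq\}$; atomic formulas are $Pt_1\dots t_m$, $t_1\doteq t_2$, $\mathbf{D}t$; $c_1\neq c_2$ abbreviates $\neg(c_1\doteq c_2)$; $A(c/x)$ is substitution of $c$ for free $x$. A Kripke $F\!F\!D\!E$-model for $\mathcal{L}$ is $\langle W,\le,d,I,i_+,i_-\rangle$ where: $W\neq\emptyset$; $\le$ is a preorder on $W$; $d$ assigns to each $w$ a set $d(w)$ (possibly empty) with $d(w)\subseteq d(w')$ whenever $w\le w'$; $I$ is a partial function on $(\mathcal{C}\cup\mathcal{P})\times W$ such that if $I(c,w)$ is defined then $I(c,w)\in d(w)$ and $I(c,w')=I(c,w)$ for all $w'\ge w$, and for each $m$-ary $P\in\mathcal{P}$, $I(P,w)=\langle P^w_+,P^w_-\rangle$ with $P^w_+,P^w_-\subseteq d(w)^m$ and $P^w_\pm\subseteq P^{w'}_\pm$ when $w\le w'$; $i_+(w),i_-(w)$ are binary relations on $d(w)$ such that (a) $i_+(w)$ is an equivalence relation that is a congruence for every $P\in\mathcal{P}$: if $\langle a_j,a'_j\rangle\in i_+(w)$ for all $j\le m$ then $\langle a_1..a_m\rangle\in P^w_+$ iff $\langle a'_1..a'_m\rangle\in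 P^w_+$, and likewise for $P^w_-$; (b) writing $\doteq^w_+=i_+(w)$, $\doteq^w_-=i_-(w)$, if for some $m$-ary $P\in\mathcal{P}^{\doteq}$ two $m$-tuples differing only in that $a$ occurs in the first where $a'$ occurs in the second (in the same positions) satisfy: the first is in $P^w_+$ and the second in $P^w_-$, then $\langle a,a'\rangle,\langle a',a\rangle\in i_-(w)$; (c) $i_\pm(w)\subseteq i_\pm(w')$ when $w\le w'$. The diagram language $\mathcal{L}_\mathcal{K}=\langle\mathcal{C}\cup\{\bar a: a\in\bigcup_w d(w)\},\mathcal{P}\rangle$ with new constants $\bar a$; $\hat I$ extends $I$ with $\hat I(\bar a,w)=a$ if $a\in d(w)$, undefined otherwise. The valuation $v:Sent(\mathcal{L}_\mathcal{K})\times W\to\{0,1\}$ induced by $\mathcal{K}$ satisfies: $v(\mathbf{D}c,w)=1$ iff $\hat I(c,w)$ defined; $v(\neg\mathbf{D}c,w)=1$ iff $\hat I(c,w)$ undefined; $v(c_1\doteq c_2,w)=1$ iff both $\hat I(c_i,w)$ defined and $\langle\hat I(c_1,w),\hat I(c_2,w)\rangle\in i_+(w)$; $v(c_1\neq c_2,w)=1$ iff both defined and the pair is in $i_-(w)$; for $P\in\mathcal{P}$, $v(Pc_1..c_m,w)=1$ iff all $\hat I(c_i,w)$ defined and $\langle\hat I(c_1,w),..,\hat I(c_m,w)\rangle\in P^w_+$, and $v(\neg Pc_1..c_m,w)=1$ iff all defined and the tuple is in $P^w_-$; $v(A\land B)=1$ iff both $1$; $v(A\lor B)=1$ iff one is $1$;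 $v(\neg(A\land B))=1$ iff $v(\neg A)=1$ or $v(\neg B)=1$; $v(\neg(A\lor B))=1$ iff $v(\neg A)=v(\neg B)=1$; $v(\neg\neg A)=v(A)$ (all at $w$); $v(\forall xA,w)=1$ iff for all $w'\ge w$ and all $a\in d(w')$, $v(A(\bar a/x),w')=1$; $v(\exists xA,w)=1$ iff $v(A(\bar a/x),w)=1$ for some $a\in d(w)$; $v(\neg\forall xA,w)=1$ iff $v(\neg A(\bar a/x),w)=1$ for some $a\in d(w)$; $v(\neg\exists xA,w)=1$ iff for all $w'\ge w$ and all $a\in d(w')$, $v(\neg A(\bar a/x),w')=1$. $\mathcal{K},w\vDash A$ means $v(A,w)=1$ for the valuation induced by $\mathcal{K}$ (and analogously for $\mathcal{K}_{c_2/c_1}$). -}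

module Defs where

open import Data.Nat using (ℕ; suc)
open import Data.Nat.Properties using (_≟_)
open import Data.Maybe using (Maybe; just; nothing; is-nothing)
open import Data.Vec using (Vec; []; _∷_; map)
open import Data.Vec.Relation.Unary.Any using (Any)
open import Data.Vec.Relation.Unary.All using (All)
open import Data.Vec.Relation.Binary.Pointwise.Inductive using (Pointwise)
open import Data.Product using (Σ; ∃; _×_; _,_)
open import Data.Sum using (_⊎_)
open import Data.Empty using (⊥)
open import Data.Bool using (T)
open import Relation.Nullary using (¬_; yes; no)
open import Relation.Binary.PropositionalEquality using (_≡_)
open import Function.Bundles using (_⇔_)

record Lang : Set₁ where
  field
    Const : Set
    Pred  : Set
    arity : Pred → ℕ
open Lang public

Var : Set
Var = ℕ

-- Terms over L with extra parameter constants drawn from X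
-- (X = ⊥ : the language L itself; X = domain : the diagram language L_K)
data Term (L : Lang) (X : Set) : Set where
  var : Var → Term L X
  con : Const L → Term L X
  par : X → Term L X

data Form (L : Lang) (X : Set) : Set where
  atom : (p : Pred L) → Vec (Term L X) (arity L p) → Form L X
  _≐_  : Term L X → Term L X → Form L X
  𝐃    : Term L X → Form L X
  ¬'_  : Form L X → Form L X
  _∧'_ : Form L X → Form L X → Form L X
  _∨'_ : Form L X → Form L X → Form L X
  ∀'   : Var → Form L X → Form L X
  ∃'   : Var → Form L X → Form L X

module _ {L : Lang} where

  embT : {X Y : Set} → (X → Y) → Term L X → Term L Y
  embT f (var x) = var x
  embT f (con c) = con c
  embT f (par a) = par (f a)

  emb : {X Y : Set} → (X → Y) → Form L X → Form L Y
  emb f (atom p ts) = atom p (map (embT f) ts)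
  emb f (t ≐ u) = embT f t ≐ embT f u
  emb f (𝐃 t) = 𝐃 (embT f t)
  emb f (¬' A) = ¬' emb f A
  emb f (A ∧' B) = emb f A ∧' emb f B
  emb f (A ∨' B) = emb f A ∨' emb f B
  emb f (∀' y A) = ∀' y (emb f A)
  emb f (∃' y A) = ∃' y (emb f A)

  subT : {X : Set} → Var → Term L X → Term L X → Term L X
  subT x t (var y) with x ≟ y
  ... | yes _ = t
  ... | no _ = var y
  subT x t (con c) = con c
  subT x t (par a) = par a

  sub : {X : Set} → Var → Term L X → Form L X → Form L X
  sub x t (atom p ts) = atom p (map (subT x t) ts)
  sub x t (u ≐ v) = subT x t u ≐ subT x t v
  sub x t (𝐃 u) = 𝐃 (subT x t u)
  sub x t (¬' A) = ¬' sub x t A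
  sub x t (A ∧' B) = sub x t A ∧' sub x t B
  sub x t (A ∨' B) = sub x t A ∨' sub x t B
  sub x t (∀' y A) with x ≟ y
  ... | yes _ = ∀' y A
  ... | no _ = ∀' y (sub x t A)
  sub x t (∃' y A) with x ≟ y
  ... | yes _ = ∃' y A
  ... | no _ = ∃' y (sub x t A)

  FreeT : {X : Set} → Var → Term L X → Set
  FreeT y (var z) = y ≡ z
  FreeT y (con c) = ⊥
  FreeT y (par a) = ⊥

  Free : {X : Set} → Var → Form L X → Set
  Free y (atom p ts) = Any (FreeT y) ts
  Free y (t ≐ u) = FreeT y t ⊎ FreeT y u
  Free y (𝐃 t) = FreeT y t
  Free y (¬' A) = Free y A
  Free y (A ∧' B) = Free y A ⊎ Free y B
  Free y (A ∨' B) = Free y A ⊎ Free y B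
  Free y (∀' z A) = ¬ (y ≡ z) × Free y A
  Free y (∃' z A) = ¬ (y ≡ z) × Free y A

  OccT : {X : Set} → Const L → Term L X → Set
  OccT c (var z) = ⊥
  OccT c (con c') = c ≡ c'
  OccT c (par a) = ⊥

  Occ : {X : Set} → Const L → Form L X → Set
  Occ c (atom p ts) = Any (OccT c) ts
  Occ c (t ≐ u) = OccT c t ⊎ OccT c u
  Occ c (𝐃 t) = OccT c t
  Occ c (¬' A) = Occ c A
  Occ c (A ∧' B) = Occ c A ⊎ Occ c B
  Occ c (A ∨' B) = Occ c A ⊎ Occ c B
  Occ c (∀' z A) = Occ c A
  Occ c (∃' z A) = Occ c A

-- Kripke structures ⟨W, ≤, d, I, i₊, i₋⟩.  Dom is a carrier containing
-- ⋃_w d(w); d w is the predicate "∈ d(w)".  I(c,w) is partial (Maybe).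

record Struct (L : Lang) : Set₁ where
  field
    W    : Set
    _≤_  : W → W → Set
    Dom  : Set
    d    : W → Dom → Set
    Ic   : Const L → W → Maybe Dom
    P⁺   : (p : Pred L) → W → Vec Dom (arity L p) → Set
    P⁻   : (p : Pred L) → W → Vec Dom (arity L p) → Set
    i⁺   : W → Dom → Dom → Set
    i⁻   : W → Dom → Dom → Set
open Struct public

fill : {D : Set} {m : ℕ} → Vec (Maybe D) m → D → Vec D m
fill [] a = []
fill (just b ∷ t) a = b ∷ fill t a
fill (nothing ∷ t) a = a ∷ fill t a

asVec2 : {D : Set} → (D → D → Set) → Vec D 2 → Set
asVec2 R (a ∷ b ∷ []) = R a b

module _ {L : Lang} (K : Struct L) where
  open Struct K renaming (W to Wk; Dom to Dk; d to dk; Ic to Ick; P⁺ to P⁺k; P⁻ to P⁻k; i⁺ to i⁺k; i⁻ to i⁻k; _≤_ to _≤k_)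

  Separation : Wk → {m : ℕ} → (Vec Dk m → Set) → (Vec Dk m → Set) → Set
  Separation w {m} R⁺ R⁻ =
    (t : Vec (Maybe Dk) m) → Any (λ e → T (is-nothing e)) t →
    (a a' : Dk) → R⁺ (fill t a) → R⁻ (fill t a') →
    i⁻k w a a' × i⁻k w a' a

  record IsModel : Set where
    field
      nonempty : Wk
      ≤-refl   : ∀ {w} → w ≤k w
      ≤-trans  : ∀ {u v w} → u ≤k v → v ≤k w → u ≤k w
      d-mono   : ∀ {w w' a} → w ≤k w' → dk w a → dk w' a
      Ic-dom   : ∀ c w a → Ick c w ≡ just a → dk w a
      Ic-mono  : ∀ c {w w'} a → w ≤k w' → Ick c w ≡ just a → Ick c w' ≡ just a
      P⁺-dom   : ∀ p w as → P⁺k p w as → All (dk w) as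
      P⁻-dom   : ∀ p w as → P⁻k p w as → All (dk w) as
      P⁺-mono  : ∀ p {w w'} as → w ≤k w' → P⁺k p w as → P⁺k p w' as
      P⁻-mono  : ∀ p {w w'} as → w ≤k w' → P⁻k p w as → P⁻k p w' as
      i⁺-dom   : ∀ w a b → i⁺k w a b → dk w a × dk w b
      i⁻-dom   : ∀ w a b → i⁻k w a b → dk w a × dk w b
      i⁺-refl  : ∀ w a → dk w a → i⁺k w a a
      i⁺-sym   : ∀ w a b → i⁺k w a b → i⁺k w b a
      i⁺-trans : ∀ w a b c → i⁺k w a b → i⁺k w b c → i⁺k w a c
      cong⁺    : ∀ p w as bs → Pointwise (i⁺k w) as bs → (P⁺k p w as ⇔ P⁺k p w bs)
      cong⁻    : ∀ p w as bs → Pointwise (i⁺k w) as bs → (P⁻k p w as ⇔ P⁻k p w bs)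
      sepP     : ∀ p w → Separation w (P⁺k p w) (P⁻k p w)
      sep≐     : ∀ w → Separation w (asVec2 (i⁺k w)) (asVec2 (i⁻k w))
      i⁺-mono  : ∀ {w w'} a b → w ≤k w' → i⁺k w a b → i⁺k w' a b
      i⁻-mono  : ∀ {w w'} a b → w ≤k w' → i⁻k w a b → i⁻k w' a b

  Den : Term L Dk → Wk → Dk → Set
  Den (var x) w a = ⊥
  Den (con c) w a = Ick c w ≡ just a
  Den (par b) w a = (b ≡ a) × dk w b

  Defined : Term L Dk → Wk → Set
  Defined t w = ∃ (Den t w)

  DenV : {m : ℕ} → Vec (Term L Dk) m → Wk → Vec Dk m → Set
  DenV ts w as = Pointwise (λ t a → Den t w a) ts as

  data _⊨_ : Wk → Form L Dk → Set where
    def    : ∀ {w t} → Defined t w → w ⊨ 𝐃 t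
    ndef   : ∀ {w t} → ¬ Defined t w → w ⊨ (¬' 𝐃 t)
    eq     : ∀ {w t u a b} → Den t w a → Den u w b → i⁺k w a b → w ⊨ (t ≐ u)
    neq    : ∀ {w t u a b} → Den t w a → Den u w b → i⁻k w a b → w ⊨ (¬' (t ≐ u))
    pos    : ∀ {w p ts as} → DenV ts w as → P⁺k p w as → w ⊨ atom p ts
    neg    : ∀ {w p ts as} → DenV ts w as → P⁻k p w as → w ⊨ (¬' atom p ts)
    and    : ∀ {w A B} → w ⊨ A → w ⊨ B → w ⊨ (A ∧' B)
    orl    : ∀ {w A B} → w ⊨ A → w ⊨ (A ∨' B)
    orr    : ∀ {w A B} → w ⊨ B → w ⊨ (A ∨' B)
    nandl  : ∀ {w A B} → w ⊨ (¬' A) → w ⊨ (¬' (A ∧' B))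
    nandr  : ∀ {w A B} → w ⊨ (¬' B) → w ⊨ (¬' (A ∧' B))
    nor    : ∀ {w A B} → w ⊨ (¬' A) → w ⊨ (¬' B) → w ⊨ (¬' (A ∨' B))
    nn     : ∀ {w A} → w ⊨ A → w ⊨ (¬' (¬' A))
    all    : ∀ {w x A} → (∀ w' → w ≤k w' → ∀ a → dk w' a → w' ⊨ sub x (par a) A)
             → w ⊨ ∀' x A
    ex     : ∀ {w x A} a → dk w a → w ⊨ sub x (par a) A → w ⊨ ∃' x A
    nall   : ∀ {w x A} a → dk w a → w ⊨ (¬' sub x (par a) A) → w ⊨ (¬' ∀' x A)
    nex    : ∀ {w x A} → (∀ w' → w ≤k w' → ∀ a → dk w' a → w' ⊨ (¬' sub x (par a) A))
             → w ⊨ (¬' ∃' x A)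

_[Ic≔_] : {L : Lang} → (K : Struct L) → (Const L → W K → Maybe (Dom K)) → Struct L
K [Ic≔ I' ] = record K { Ic = I' }

{-# OPTIONS --safe #-}
-- Above w, the constant c₁ of K_{c₂/c₁} and the constant c₂ of K both denote a (I(c₂,·) is
-- persistent), and every other constant is interpreted alike.  So terms that agree up to
-- replacing c₁ by c₂ denote the same object at every world above w.  The valuation clauses
-- only visit worlds above the current one and only substitute parameters, which preserves
-- this correspondence; hence satisfaction transfers along it in both directions.
module Submission where

open import Defs
open import Data.Nat using (ℕ)
open import Data.Nat.Properties using (_≟_)
open import Data.Maybe using (Maybe; just; nothing)
open import Data.Empty using (⊥; ⊥-elim)
open import Data.Product using (_,_)
open import Data.Sum using (inj₁; inj₂)
open import Data.Vec using (Vec; []; _∷_; map)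
open import Data.Vec.Relation.Unary.Any using (Any; here; there)
open import Data.Vec.Relation.Binary.Pointwise.Inductive as Pointwise using (Pointwise; []; _∷_)
open import Function using (id; flip; _∘_)
open import Function.Bundles using (_⇔_; mk⇔; Equivalence)
open import Function.Properties.Equivalence using (⇔-isEquivalence)
open import Relation.Binary.Structures using (IsEquivalence)
open import Relation.Nullary using (¬_; yes; no)
open import Relation.Binary.PropositionalEquality using (_≡_; sym; trans)
open import Level using (0ℓ)

private
  module ⇔ = IsEquivalence (⇔-isEquivalence {ℓ = 0ℓ})

module _ {L : Lang} {X : Set} where

  data Pointwiseᶠ (R : Term L X → Term L X → Set) : Form L X → Form L X → Set where
    atom : ∀ {p ts us} → Pointwise R ts us → Pointwiseᶠ R (atom p ts) (atom p us)
    _≐_  : ∀ {t t' u u'} → R t t' → R u u' → Pointwiseᶠ R (t ≐ u) (t' ≐ u')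
    𝐃    : ∀ {t u} → R t u → Pointwiseᶠ R (𝐃 t) (𝐃 u)
    ¬'_  : ∀ {A B} → Pointwiseᶠ R A B → Pointwiseᶠ R (¬' A) (¬' B)
    _∧'_ : ∀ {A B A' B'} → Pointwiseᶠ R A A' → Pointwiseᶠ R B B' → Pointwiseᶠ R (A ∧' B) (A' ∧' B')
    _∨'_ : ∀ {A B A' B'} → Pointwiseᶠ R A A' → Pointwiseᶠ R B B' → Pointwiseᶠ R (A ∨' B) (A' ∨' B')
    ∀'   : ∀ {y A B} → Pointwiseᶠ R A B → Pointwiseᶠ R (∀' y A) (∀' y B)
    ∃'   : ∀ {y A B} → Pointwiseᶠ R A B → Pointwiseᶠ R (∃' y A) (∃' y B)

  Pointwiseᶠ-sym : ∀ {R A B} → Pointwiseᶠ R A B → Pointwiseᶠ (flip R) B A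
  Pointwiseᶠ-sym (atom rs)  = atom (Pointwise.sym id rs)
  Pointwiseᶠ-sym (r ≐ s)    = r ≐ s
  Pointwiseᶠ-sym (𝐃 r)      = 𝐃 r
  Pointwiseᶠ-sym (¬' r)     = ¬' Pointwiseᶠ-sym r
  Pointwiseᶠ-sym (r ∧' s)   = Pointwiseᶠ-sym r ∧' Pointwiseᶠ-sym s
  Pointwiseᶠ-sym (r ∨' s)   = Pointwiseᶠ-sym r ∨' Pointwiseᶠ-sym s
  Pointwiseᶠ-sym (∀' r)     = ∀' (Pointwiseᶠ-sym r)
  Pointwiseᶠ-sym (∃' r)     = ∃' (Pointwiseᶠ-sym r)

  Pointwiseᶠ-sub : ∀ {R y s s' A B} →
                   (∀ {t u} → R t u → R (subT y s t) (subT y s' u)) →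
                   Pointwiseᶠ R A B → Pointwiseᶠ R (sub y s A) (sub y s' B)
  Pointwiseᶠ-sub sub-R (atom rs) = atom (Pointwise.map⁺ sub-R rs)
  Pointwiseᶠ-sub sub-R (r ≐ s)   = sub-R r ≐ sub-R s
  Pointwiseᶠ-sub sub-R (𝐃 r)     = 𝐃 (sub-R r)
  Pointwiseᶠ-sub sub-R (¬' r)    = ¬' Pointwiseᶠ-sub sub-R r
  Pointwiseᶠ-sub sub-R (r ∧' s)  = Pointwiseᶠ-sub sub-R r ∧' Pointwiseᶠ-sub sub-R s
  Pointwiseᶠ-sub sub-R (r ∨' s)  = Pointwiseᶠ-sub sub-R r ∨' Pointwiseᶠ-sub sub-R s
  Pointwiseᶠ-sub {y = y} sub-R (∀' {z} r) with y ≟ z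
  ... | yes _ = ∀' r
  ... | no _  = ∀' (Pointwiseᶠ-sub sub-R r)
  Pointwiseᶠ-sub {y = y} sub-R (∃' {z} r) with y ≟ z
  ... | yes _ = ∃' r
  ... | no _  = ∃' (Pointwiseᶠ-sub sub-R r)

record Simulation {L : Lang} (K : Struct L) (I₁ I₂ : Const L → W K → Maybe (Dom K)) : Set₁ where
  field
    Upset        : W K → Set
    Upset-closed : ∀ {u v} → Upset u → _≤_ K u v → Upset v
    _~_          : Term L (Dom K) → Term L (Dom K) → Set
    ~-den        : ∀ {t u w} → t ~ u → Upset w → ∀ b → Den (K [Ic≔ I₁ ]) t w b ⇔ Den (K [Ic≔ I₂ ]) u w b
    ~-subT       : ∀ y b {t u} → t ~ u → subT y (par b) t ~ subT y (par b) u

module _ {L : Lang} {K : Struct L} {I₁ I₂ : Const L → W K → Maybe (Dom K)} (S : Simulation K I₁ I₂) where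
  open Simulation S

  private
    den⁺ : ∀ {t u w b} → t ~ u → Upset w → Den (K [Ic≔ I₁ ]) t w b → Den (K [Ic≔ I₂ ]) u w b
    den⁺ r up = Equivalence.to (~-den r up _)

    den⁻ : ∀ {t u w b} → t ~ u → Upset w → Den (K [Ic≔ I₂ ]) u w b → Den (K [Ic≔ I₁ ]) t w b
    den⁻ r up = Equivalence.from (~-den r up _)

    denᵛ : ∀ {m w} {ts us : Vec _ m} {as} → Upset w → Pointwise _~_ ts us →
           DenV (K [Ic≔ I₁ ]) ts w as → DenV (K [Ic≔ I₂ ]) us w as
    denᵛ up []       []       = []
    denᵛ up (r ∷ rs) (d ∷ ds) = den⁺ r up d ∷ denᵛ up rs ds

    sub-par : ∀ y b {A B} → Pointwiseᶠ _~_ A B → Pointwiseᶠ _~_ (sub y (par b) A) (sub y (par b) B)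
    sub-par y b = Pointwiseᶠ-sub (~-subT y b)

  ⊨-transfer : ∀ {w A B} → Upset w → Pointwiseᶠ _~_ A B → _⊨_ (K [Ic≔ I₁ ]) w A → _⊨_ (K [Ic≔ I₂ ]) w B
  ⊨-transfer up (𝐃 r)          (def (b , d))  = def (b , den⁺ r up d)
  ⊨-transfer up (¬' 𝐃 r)       (ndef nd)      = ndef (λ (b , d) → nd (b , den⁻ r up d))
  ⊨-transfer up (r ≐ s)        (eq d e i)     = eq (den⁺ r up d) (den⁺ s up e) i
  ⊨-transfer up (¬' (r ≐ s))   (neq d e i)    = neq (den⁺ r up d) (den⁺ s up e) i
  ⊨-transfer up (atom rs)      (pos ds p)     = pos (denᵛ up rs ds) p
  ⊨-transfer up (¬' atom rs)   (neg ds p)     = neg (denᵛ up rs ds) p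
  ⊨-transfer up (r ∧' s)       (and d e)      = and (⊨-transfer up r d) (⊨-transfer up s e)
  ⊨-transfer up (r ∨' s)       (orl d)        = orl (⊨-transfer up r d)
  ⊨-transfer up (r ∨' s)       (orr d)        = orr (⊨-transfer up s d)
  ⊨-transfer up (¬' (r ∧' s))  (nandl d)      = nandl (⊨-transfer up (¬' r) d)
  ⊨-transfer up (¬' (r ∧' s))  (nandr d)      = nandr (⊨-transfer up (¬' s) d)
  ⊨-transfer up (¬' (r ∨' s))  (nor d e)      = nor (⊨-transfer up (¬' r) d) (⊨-transfer up (¬' s) e)
  ⊨-transfer up (¬' ¬' r)      (nn d)         = nn (⊨-transfer up r d)
  ⊨-transfer up (∀' {y} r)     (all f)        =
    all (λ w' le b db → ⊨-transfer (Upset-closed up le) (sub-par y b r) (f w' le b db))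
  ⊨-transfer up (∃' {y} r)     (ex b db d)    = ex b db (⊨-transfer up (sub-par y b r) d)
  ⊨-transfer up (¬' ∀' {y} r)  (nall b db d)  = nall b db (⊨-transfer up (¬' sub-par y b r) d)
  ⊨-transfer up (¬' ∃' {y} r)  (nex f)        =
    nex (λ w' le b db → ⊨-transfer (Upset-closed up le) (¬' sub-par y b r) (f w' le b db))

module _ {L : Lang} {K : Struct L} {I₁ I₂ : Const L → W K → Maybe (Dom K)} where

  Simulation-sym : Simulation K I₁ I₂ → Simulation K I₂ I₁
  Simulation-sym S = record
    { Upset        = Upset
    ; Upset-closed = Upset-closed
    ; _~_          = flip _~_
    ; ~-den        = λ r up b → ⇔.sym (~-den r up b)
    ; ~-subT       = λ y b → ~-subT y b
    }
    where open Simulation S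

  ⊨-cong : (S : Simulation K I₁ I₂) → let open Simulation S in
           ∀ {w A B} → Upset w → Pointwiseᶠ _~_ A B → _⊨_ (K [Ic≔ I₁ ]) w A ⇔ _⊨_ (K [Ic≔ I₂ ]) w B
  ⊨-cong S up r = mk⇔ (⊨-transfer S up r) (⊨-transfer (Simulation-sym S) up (Pointwiseᶠ-sym r))

module _ {L : Lang} {X : Set} (c₁ c₂ : Const L) where

  data Rename : Term L X → Term L X → Set where
    var   : ∀ z → Rename (var z) (var z)
    con   : ∀ {c} → ¬ c ≡ c₁ → Rename (con c) (con c)
    par   : ∀ b → Rename (par b) (par b)
    c₁↦c₂ : Rename (con c₁) (con c₂)

  Rename-subT : ∀ {y s s' t u} → Rename s s' → Rename t u → Rename (subT y s t) (subT y s' u)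
  Rename-subT {y} r (var z) with y ≟ z
  ... | yes _ = r
  ... | no _  = var z
  Rename-subT r (con c≢c₁) = con c≢c₁
  Rename-subT r (par b)    = par b
  Rename-subT r c₁↦c₂      = c₁↦c₂

  module _ {Y : Set} (f : Y → X) where

    Rename-embT : (t : Term L Y) → ¬ OccT c₁ t → Rename (embT f t) (embT f t)
    Rename-embT (var z) _    = var z
    Rename-embT (con c) c₁∉t = con (c₁∉t ∘ sym)
    Rename-embT (par b) _    = par (f b)

    Rename-emb : (A : Form L Y) → ¬ Occ c₁ A → Pointwiseᶠ Rename (emb f A) (emb f A)
    Rename-emb (atom p ts) c₁∉A = atom (Rename-embᵛ ts c₁∉A)
      where
      Rename-embᵛ : ∀ {m} (ts : Vec (Term L Y) m) → ¬ Any (OccT c₁) ts →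
                    Pointwise Rename (map (embT f) ts) (map (embT f) ts)
      Rename-embᵛ []       _     = []
      Rename-embᵛ (t ∷ ts) c₁∉ts = Rename-embT t (c₁∉ts ∘ here) ∷ Rename-embᵛ ts (c₁∉ts ∘ there)
    Rename-emb (t ≐ u) c₁∉A  = Rename-embT t (c₁∉A ∘ inj₁) ≐ Rename-embT u (c₁∉A ∘ inj₂)
    Rename-emb (𝐃 t) c₁∉A    = 𝐃 (Rename-embT t c₁∉A)
    Rename-emb (¬' A) c₁∉A   = ¬' Rename-emb A c₁∉A
    Rename-emb (A ∧' B) c₁∉A = Rename-emb A (c₁∉A ∘ inj₁) ∧' Rename-emb B (c₁∉A ∘ inj₂)
    Rename-emb (A ∨' B) c₁∉A = Rename-emb A (c₁∉A ∘ inj₁) ∨' Rename-emb B (c₁∉A ∘ inj₂)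
    Rename-emb (∀' y A) c₁∉A = ∀' (Rename-emb A c₁∉A)
    Rename-emb (∃' y A) c₁∉A = ∃' (Rename-emb A c₁∉A)

lemma14 : (L : Lang) (c₁ c₂ : Const L) (K : Struct L) → IsModel K →
    (w : W K) (a : Dom K) → Ic K c₂ w ≡ just a →
    (I' : Const L → W K → Maybe (Dom K)) →
    (∀ c → ¬ (c ≡ c₁) → ∀ w' → I' c w' ≡ Ic K c w') →
    (∀ w' b → Ic K c₂ w' ≡ just b → I' c₁ w' ≡ just a) →
    (∀ w' → Ic K c₂ w' ≡ nothing → I' c₁ w' ≡ nothing) →
    (A : Form L ⊥) (x : ℕ) →
    (∀ y → Free y A → y ≡ x) → ¬ Occ c₁ A →
    (_⊨_ (K [Ic≔ I' ]) w (sub x (con c₁) (emb ⊥-elim A))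
    ⇔ _⊨_ K w (sub x (con c₂) (emb ⊥-elim A)))
-- Only worlds above w are visited, and c₂ is defined there.  Nor is the one on free variables: a variable left
-- free denotes nothing in either model.
lemma14 L c₁ c₂ K M w a c₂↦a I' I'-agrees I'-c₁ _ A x _ c₁∉A =
  ⊨-cong above-w (IsModel.≤-refl M)
    (Pointwiseᶠ-sub (Rename-subT c₁ c₂ c₁↦c₂) (Rename-emb c₁ c₂ ⊥-elim A c₁∉A))
  where
  same-lhs : ∀ {m n k : Maybe (Dom K)} → m ≡ n → (m ≡ k) ⇔ (n ≡ k)
  same-lhs m≡n = mk⇔ (trans (sym m≡n)) (trans m≡n)

  den : ∀ {t u w'} → Rename c₁ c₂ t u → _≤_ K w w' → ∀ b → Den (K [Ic≔ I' ]) t w' b ⇔ Den K u w' b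
  den (var z)    _    _ = ⇔.refl
  den (con c≢c₁) _    _ = same-lhs (I'-agrees _ c≢c₁ _)
  den (par b)    _    _ = ⇔.refl
  den {w' = w'} c₁↦c₂ w≤w' _ = same-lhs (trans (I'-c₁ w' a c₂↦a') (sym c₂↦a'))
    where
    c₂↦a' : Ic K c₂ w' ≡ just a
    c₂↦a' = IsModel.Ic-mono M c₂ a w≤w' c₂↦a

  above-w : Simulation K I' (Ic K)
  above-w = record
    { Upset        = _≤_ K w
    ; Upset-closed = IsModel.≤-trans M
    ; _~_          = Rename c₁ c₂
    ; ~-den        = den
    ; ~-subT       = λ y b → Rename-subT c₁ c₂ (par b)
    }
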